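{- Let $t=7$, let $X\subset\mathbb{F}_2^7$ be the subspace $\{0,(1,\dots,1)\}$, and let $1\le k\le 3$. Define the linear map $T_{2k}:\mathbb{F}_2^7/X\to\mathbb{F}_2$, $(u_1,\dots,u_7)\mapsto\sum_{j=1}^{2k}u_j$ (sum in $\mathbb{F}_2$), and let $V^{(2k)}=\ker T_{2k}$. Define $S$ on $\mathbb{F}_2^7/X$ by sending the class of $(e_1,\dots,e_7)$ (with $e_j\in\{0,1\}$) to $\min\{\sum_j e_j,\ 7-\sum_j e_j\}$ (sums in $\mathbb{N}$), and put $V^{(2k)}_\nu=\{u\in V^{(2k)}: S(u)=\nu\}$. If $U$ is a $4$-dimensional $\mathbb{F}_2$-subspace of $V^{(2k)}$, then at least one of $U\cap V^{(2k)}_1$ and $U\cap V^{(2k)}_2$ is nonempty.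
   Context: $T_{2k}$ is well defined on the quotient since $T_{2k}(1,\dots,1)=2k=0$ in $\mathbb{F}_2$, and $S$ is well defined since adding $(1,\dots,1)$ replaces $\sum e_j$ by $7-\sum e_j$. -}

module Defs where

open import Data.Bool using (Bool; true; false; _xor_; if_then_else_)
open import Data.Nat using (ℕ; zero; suc; _+_; _∸_; _⊓_)
open import Data.Fin using (Fin; zero; suc)
open import Data.Vec using (Vec; []; _∷_; zipWith; replicate)
open import Data.Product using (∃; _×_)
open import Data.Sum using (_⊎_)
open import Function.Bundles using (_⇔_)
open import Relation.Binary.PropositionalEquality using (_≡_)

-- 𝔽₂ is modelled by Bool (addition = xor); 𝔽₂^7 by Vec Bool 7.
F2^7 : Set
F2^7 = Vec Bool 7

_⊕_ : ∀ {n} → Vec Bool n → Vec Bool n → Vec Bool n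
_⊕_ = zipWith _xor_

𝟘 : F2^7
𝟘 = replicate 7 false

𝟙 : F2^7
𝟙 = replicate 7 true

-- Elements of 𝔽₂^7 / X, X = {0, (1,…,1)}, are represented by vectors;
-- two representatives give the same class iff they differ by an element of X.
_≈X_ : F2^7 → F2^7 → Set
u ≈X v = (u ≡ v) ⊎ (u ≡ v ⊕ 𝟙)

firstSum : ∀ {n} → ℕ → Vec Bool n → Bool
firstSum zero    _        = false
firstSum (suc m) []       = false
firstSum (suc m) (x ∷ xs) = x xor firstSum m xs

T : ℕ → F2^7 → Bool
T k u = firstSum (2 Data.Nat.* k) u

weight : ∀ {n} → Vec Bool n → ℕ
weight []           = 0
weight (true  ∷ xs) = suc (weight xs)
weight (false ∷ xs) = weight xs

S : F2^7 → ℕ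
S e = weight e ⊓ (7 ∸ weight e)

InV : ℕ → F2^7 → Set
InV k u = T k u ≡ false

InVν : ℕ → ℕ → F2^7 → Set
InVν k ν u = InV k u × S u ≡ ν

lincomb : ∀ {d} → (Fin d → Bool) → (Fin d → F2^7) → F2^7
lincomb {zero}  c b = 𝟘
lincomb {suc d} c b =
  (if c zero then b zero else 𝟘) ⊕ lincomb (λ i → c (suc i)) (λ i → b (suc i))

-- U (a predicate on representatives) is a d-dimensional 𝔽₂-subspace of 𝔽₂^7/X:
-- it is the span of d vectors whose classes are linearly independent in 𝔽₂^7/X.
record IsSubspaceOfDim (d : ℕ) (U : F2^7 → Set) : Set₁ where
  field
    basis : Fin d → F2^7
    spans : ∀ u → U u ⇔ (∃ λ (c : Fin d → Bool) → u ≈X lincomb c basis)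
    indep : ∀ (c : Fin d → Bool) → lincomb c basis ≈X 𝟘 → ∀ i → c i ≡ false

{-# OPTIONS --safe #-}
-- Put σ(v) = signedSum v = Σⱼ (−1)^{vⱼ} = 7 − 2·weight v. Then S v = 0 iff v ≈X 𝟘, and S v = 3 iff σ(v)² = 1.
-- If the span of a basis b₁,…,b₄ avoided S ∈ {1,2}, the 16 combinations c·b would give
-- Σ_c σ(c·b)² ≤ 7² + 15 = 64. But expanding the square and using orthogonality of the
-- characters c ↦ (−1)^{c·x} of 𝔽₂⁴ gives Σ_c σ(c·b)² = 16·#{(j,j′) : column j = column j′} ≥ 16·7 = 112.
module Submission where

open import Defs
open import Algebra.Bundles using (CommutativeRing)
open import Data.Bool using (Bool; true; false; not; _xor_; _∧_; if_then_else_)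
open import Data.Bool.Properties using (xor-∧-commutativeRing; ∧-distribˡ-xor)
open import Data.Empty using (⊥-elim)
open import Data.Fin using (Fin; zero; suc)
open import Data.Integer using (ℤ; +_; -[1+_]; _⊖_; -_; _+_; _-_; _*_; _≤_; +≤+; _≤?_)
import Data.Integer.Properties as ℤ
open import Data.Nat as ℕ using (ℕ; suc; _∸_; _^_; s≤s; z≤n)
import Data.Nat.Properties as ℕ
open import Data.Nat.Tactic.RingSolver using (solve-∀)
open import Data.Product using (∃; _×_; _,_)
open import Data.Sum using (_⊎_; inj₁; inj₂)
open import Data.Vec using (Vec; []; _∷_; lookup; replicate; tabulate)
open import Data.Vec.Properties using (lookup-replicate; lookup-zipWith)
open import Function using (_∘_; case_of_)
open import Function.Bundles using (Equivalence)
open import Relation.Binary.PropositionalEquality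
open import Relation.Nullary using (¬_)
open import Relation.Nullary.Decidable using (toWitnessFalse)

open import Algebra.Properties.Semiring.Sum ℤ.+-*-semiring
  using (sum; sum-syntax; sum-cong-≗; ∑-distrib-+; *-distribˡ-sum; *-distribʳ-sum)
open import Algebra.Properties.CommutativeSemigroup
  (CommutativeRing.+-commutativeSemigroup xor-∧-commutativeRing)
  using () renaming (interchange to xor-interchange)

private
  variable
    n d : ℕ

square : ℤ → ℤ
square x = x * x

sum-mono-≤ : {f g : Fin n → ℤ} → (∀ i → f i ≤ g i) → sum f ≤ sum g
sum-mono-≤ {ℕ.zero} f≤g = ℤ.≤-refl
sum-mono-≤ {suc n}  f≤g = ℤ.+-mono-≤ (f≤g zero) (sum-mono-≤ (f≤g ∘ suc))

sum-nonneg : {f : Fin n → ℤ} → (∀ i → + 0 ≤ f i) → + 0 ≤ sum f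
sum-nonneg {ℕ.zero} f≥0 = ℤ.≤-refl
sum-nonneg {suc n}  f≥0 = ℤ.+-mono-≤ (f≥0 zero) (sum-nonneg (f≥0 ∘ suc))

term≤sum : {f : Fin n → ℤ} → (∀ i → + 0 ≤ f i) → ∀ i → f i ≤ sum f
term≤sum {suc n} {f} f≥0 zero =
  subst (_≤ sum f) (ℤ.+-identityʳ (f zero)) (ℤ.+-monoʳ-≤ (f zero) (sum-nonneg (f≥0 ∘ suc)))
term≤sum {suc n} {f} f≥0 (suc i) =
  subst (_≤ sum f) (ℤ.+-identityˡ (f (suc i))) (ℤ.+-mono-≤ (f≥0 zero) (term≤sum (f≥0 ∘ suc) i))

sum-const : ∀ n m → ∑[ i < n ] (+ m) ≡ + (n ℕ.* m)
sum-const ℕ.zero    m = refl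
sum-const (suc n) m = cong (_+_ (+ m)) (sum-const n m)

square-sum : (f : Fin n → ℤ) → square (sum f) ≡ ∑[ i < n ] ∑[ j < n ] (f i * f j)
square-sum f = trans (*-distribʳ-sum (sum f) f) (sum-cong-≗ λ i → *-distribˡ-sum (f i) f)

χ : Bool → ℤ
χ false = + 1
χ true  = -[1+ 0 ]

χ-xor : ∀ a b → χ (a xor b) ≡ χ a * χ b
χ-xor false b     = sym (ℤ.*-identityˡ (χ b))
χ-xor true  false = refl
χ-xor true  true  = refl

χ-not : ∀ a → χ (not a) ≡ - χ a
χ-not false = refl
χ-not true  = refl

χ-square : ∀ a → square (χ a) ≡ + 1
χ-square false = refl
χ-square true  = refl

_·_ : Vec Bool d → Vec Bool d → Bool
[]       · []       = false
(c ∷ cs) · (x ∷ xs) = (c ∧ x) xor (cs · xs)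

·-distribˡ-⊕ : (c x y : Vec Bool d) → c · (x ⊕ y) ≡ (c · x) xor (c · y)
·-distribˡ-⊕ []       []       []       = refl
·-distribˡ-⊕ (c ∷ cs) (x ∷ xs) (y ∷ ys) = begin
  (c ∧ (x xor y)) xor (cs · (xs ⊕ ys))               ≡⟨ cong₂ _xor_ (∧-distribˡ-xor c x y) (·-distribˡ-⊕ cs xs ys) ⟩
  ((c ∧ x) xor (c ∧ y)) xor ((cs · xs) xor (cs · ys)) ≡⟨ xor-interchange (c ∧ x) (c ∧ y) (cs · xs) (cs · ys) ⟩
  ((c ∧ x) xor (cs · xs)) xor ((c ∧ y) xor (cs · ys)) ∎
  where open ≡-Reasoning

∑ᴮ : ∀ d → (Vec Bool d → ℤ) → ℤ
∑ᴮ ℕ.zero  f = f []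
∑ᴮ (suc d) f = ∑ᴮ d (f ∘ (false ∷_)) + ∑ᴮ d (f ∘ (true ∷_))

∑ᴮ-cong : ∀ d {f g : Vec Bool d → ℤ} → (∀ c → f c ≡ g c) → ∑ᴮ d f ≡ ∑ᴮ d g
∑ᴮ-cong ℕ.zero  f≗g = f≗g []
∑ᴮ-cong (suc d) f≗g = cong₂ _+_ (∑ᴮ-cong d (f≗g ∘ (false ∷_))) (∑ᴮ-cong d (f≗g ∘ (true ∷_)))

∑ᴮ-mono-≤ : ∀ d {f g : Vec Bool d → ℤ} → (∀ c → f c ≤ g c) → ∑ᴮ d f ≤ ∑ᴮ d g
∑ᴮ-mono-≤ ℕ.zero  f≤g = f≤g []
∑ᴮ-mono-≤ (suc d) f≤g = ℤ.+-mono-≤ (∑ᴮ-mono-≤ d (f≤g ∘ (false ∷_))) (∑ᴮ-mono-≤ d (f≤g ∘ (true ∷_)))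

∑ᴮ-one : ∀ d → ∑ᴮ d (λ _ → + 1) ≡ + (2 ^ d)
∑ᴮ-one ℕ.zero  = refl
∑ᴮ-one (suc d) = begin
  ∑ᴮ d (λ _ → + 1) + ∑ᴮ d (λ _ → + 1) ≡⟨ cong₂ _+_ (∑ᴮ-one d) (∑ᴮ-one d) ⟩
  + (2 ^ d ℕ.+ 2 ^ d)                  ≡⟨ cong (λ m → + (2 ^ d ℕ.+ m)) (sym (ℕ.+-identityʳ (2 ^ d))) ⟩
  + (2 ^ suc d)                        ∎
  where open ≡-Reasoning

∑ᴮ-neg : ∀ d (f : Vec Bool d → ℤ) → ∑ᴮ d (λ c → - f c) ≡ - ∑ᴮ d f
∑ᴮ-neg ℕ.zero  f = refl
∑ᴮ-neg (suc d) f = trans (cong₂ _+_ (∑ᴮ-neg d (f ∘ (false ∷_))) (∑ᴮ-neg d (f ∘ (true ∷_))))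
                         (sym (ℤ.neg-distrib-+ (∑ᴮ d (f ∘ (false ∷_))) (∑ᴮ d (f ∘ (true ∷_)))))

∑ᴮ-comm-∑ : ∀ d (f : Vec Bool d → Fin n → ℤ) →
            ∑ᴮ d (λ c → ∑[ j < n ] f c j) ≡ ∑[ j < n ] ∑ᴮ d (λ c → f c j)
∑ᴮ-comm-∑ ℕ.zero  f = refl
∑ᴮ-comm-∑ (suc d) f =
  trans (cong₂ _+_ (∑ᴮ-comm-∑ d (f ∘ (false ∷_))) (∑ᴮ-comm-∑ d (f ∘ (true ∷_))))
        (sym (∑-distrib-+ (λ j → ∑ᴮ d (λ c → f (false ∷ c) j)) (λ j → ∑ᴮ d (λ c → f (true ∷ c) j))))

characterSum-nonneg : (z : Vec Bool d) → + 0 ≤ ∑ᴮ d (λ c → χ (c · z))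
characterSum-nonneg []          = +≤+ z≤n
characterSum-nonneg (false ∷ z) = ℤ.+-mono-≤ (characterSum-nonneg z) (characterSum-nonneg z)
characterSum-nonneg {suc d} (true ∷ z) = ℤ.≤-reflexive (sym (begin
  Σ + ∑ᴮ d (λ c → χ (not (c · z))) ≡⟨ cong (_+_ Σ) (∑ᴮ-cong d (χ-not ∘ (_· z))) ⟩
  Σ + ∑ᴮ d (λ c → - χ (c · z))     ≡⟨ cong (_+_ Σ) (∑ᴮ-neg d (λ c → χ (c · z))) ⟩
  Σ - Σ                            ≡⟨ ℤ.+-inverseʳ Σ ⟩
  + 0                              ∎))
  where
  open ≡-Reasoning
  Σ = ∑ᴮ d (λ c → χ (c · z))

correlation : Vec Bool d → Vec Bool d → ℤ
correlation {d} x y = ∑ᴮ d (λ c → χ (c · x) * χ (c · y))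

correlation-nonneg : (x y : Vec Bool d) → + 0 ≤ correlation x y
correlation-nonneg {d} x y = subst (+ 0 ≤_) (∑ᴮ-cong d χ-product) (characterSum-nonneg (x ⊕ y))
  where
  χ-product : ∀ c → χ (c · (x ⊕ y)) ≡ χ (c · x) * χ (c · y)
  χ-product c = trans (cong χ (·-distribˡ-⊕ c x y)) (χ-xor (c · x) (c · y))

correlation-self : (x : Vec Bool d) → correlation x x ≡ + (2 ^ d)
correlation-self {d} x = trans (∑ᴮ-cong d (χ-square ∘ (_· x))) (∑ᴮ-one d)

parseval-≥ : (r : Fin n → Vec Bool d) →
             + (n ℕ.* 2 ^ d) ≤ ∑ᴮ d (λ c → square (∑[ j < n ] χ (c · r j)))
parseval-≥ {n} {d} r = begin
  + (n ℕ.* 2 ^ d)                                     ≡⟨ sum-const n (2 ^ d) ⟨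
  ∑[ j < n ] (+ (2 ^ d))                              ≡⟨ sum-cong-≗ (correlation-self ∘ r) ⟨
  ∑[ j < n ] correlation (r j) (r j)                  ≤⟨ sum-mono-≤ (λ j → term≤sum (correlation-nonneg (r j) ∘ r) j) ⟩
  ∑[ j < n ] ∑[ k < n ] correlation (r j) (r k)       ≡⟨ sum-cong-≗ (λ j → ∑ᴮ-comm-∑ d (λ c k → χ (c · r j) * χ (c · r k))) ⟨
  ∑[ j < n ] ∑ᴮ d (λ c → ∑[ k < n ] (χ (c · r j) * χ (c · r k)))
                                                      ≡⟨ ∑ᴮ-comm-∑ d (λ c j → ∑[ k < n ] (χ (c · r j) * χ (c · r k))) ⟨
  ∑ᴮ d (λ c → ∑[ j < n ] ∑[ k < n ] (χ (c · r j) * χ (c · r k)))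
                                                      ≡⟨ ∑ᴮ-cong d (λ c → square-sum (λ j → χ (c · r j))) ⟨
  ∑ᴮ d (λ c → square (∑[ j < n ] χ (c · r j)))        ∎
  where open ℤ.≤-Reasoning

Nonzero : Vec Bool d → Set
Nonzero c = ∃ λ i → lookup c i ≡ true

∑ᴮ-≤ : ∀ d e {f : Vec Bool d → ℤ} → f (replicate d false) ≤ + suc e →
       (∀ c → Nonzero c → f c ≤ + 1) → ∑ᴮ d f ≤ + (2 ^ d ℕ.+ e)
∑ᴮ-≤ ℕ.zero  e f₀≤ f≤1 = f₀≤
∑ᴮ-≤ (suc d) e {f} f₀≤ f≤1 = begin
  ∑ᴮ d (f ∘ (false ∷_)) + ∑ᴮ d (f ∘ (true ∷_)) ≤⟨ ℤ.+-mono-≤ zero-half nonzero-half ⟩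
  + (2 ^ d ℕ.+ e) + + (2 ^ d)                 ≡⟨ cong +_ (arith (2 ^ d) e) ⟩
  + (2 ^ suc d ℕ.+ e)                         ∎
  where
  open ℤ.≤-Reasoning
  arith : ∀ m e → m ℕ.+ e ℕ.+ m ≡ m ℕ.+ (m ℕ.+ 0) ℕ.+ e
  arith = solve-∀
  zero-half : ∑ᴮ d (f ∘ (false ∷_)) ≤ + (2 ^ d ℕ.+ e)
  zero-half = ∑ᴮ-≤ d e f₀≤ (λ { c (i , cᵢ≡1) → f≤1 (false ∷ c) (suc i , cᵢ≡1) })
  nonzero-half : ∑ᴮ d (f ∘ (true ∷_)) ≤ + (2 ^ d)
  nonzero-half = ℤ.≤-trans (∑ᴮ-mono-≤ d (λ c → f≤1 (true ∷ c) (zero , refl))) (ℤ.≤-reflexive (∑ᴮ-one d))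

signedSum : Vec Bool n → ℤ
signedSum {n} v = ∑[ j < n ] χ (lookup v j)

weight≤length : (v : Vec Bool n) → weight v ℕ.≤ n
weight≤length []          = z≤n
weight≤length (true ∷ v)  = s≤s (weight≤length v)
weight≤length (false ∷ v) = ℕ.m≤n⇒m≤1+n (weight≤length v)

weight≡0⇒all-false : (v : Vec Bool n) → weight v ≡ 0 → v ≡ replicate n false
weight≡0⇒all-false []          _   = refl
weight≡0⇒all-false (true ∷ v)  ()
weight≡0⇒all-false (false ∷ v) w≡0 = cong (false ∷_) (weight≡0⇒all-false v w≡0)

weight≡length⇒all-true : (v : Vec Bool n) → weight v ≡ n → v ≡ replicate n true
weight≡length⇒all-true []          _   = refl
weight≡length⇒all-true (true ∷ v)  w≡n = cong (true ∷_) (weight≡length⇒all-true v (ℕ.suc-injective w≡n))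
weight≡length⇒all-true (false ∷ v) w≡n = ⊥-elim (ℕ.1+n≰n (subst (ℕ._≤ _) w≡n (weight≤length v)))

signedSum-weight : (v : Vec Bool n) → signedSum v ≡ (n ∸ weight v) ⊖ weight v
signedSum-weight [] = refl
signedSum-weight {suc n} (true ∷ v) =
  trans (cong (_+_ -[1+ 0 ]) (signedSum-weight v)) (ℤ.distribʳ-⊖-+-neg 0 (n ∸ weight v) (weight v))
signedSum-weight {suc n} (false ∷ v) = begin
  + 1 + signedSum v                 ≡⟨ cong (_+_ (+ 1)) (signedSum-weight v) ⟩
  + 1 + ((n ∸ weight v) ⊖ weight v) ≡⟨ ℤ.distribʳ-⊖-+-pos 1 (n ∸ weight v) (weight v) ⟩
  suc (n ∸ weight v) ⊖ weight v     ≡⟨ cong (_⊖ weight v) (ℕ.+-∸-assoc 1 (weight≤length v)) ⟨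
  (suc n ∸ weight v) ⊖ weight v     ∎
  where open ≡-Reasoning

square-signedSum-by-weight : (v : F2^7) {w : ℕ} → weight v ≡ w →
                             square (signedSum v) ≡ square ((7 ∸ w) ⊖ w)
square-signedSum-by-weight v w≡ =
  cong square (trans (signedSum-weight v) (cong (λ w → (7 ∸ w) ⊖ w) w≡))

classify-by-weight : (v : F2^7) → (S v ≡ 1 ⊎ S v ≡ 2) ⊎ (v ≈X 𝟘 ⊎ square (signedSum v) ≡ + 1)
classify-by-weight v with weight v in w≡ | weight≤length v
... | _ | z≤n                                                 = inj₂ (inj₁ (inj₁ (weight≡0⇒all-false v w≡)))
... | _ | s≤s z≤n                                             = inj₁ (inj₁ refl)
... | _ | s≤s (s≤s z≤n)                                       = inj₁ (inj₂ refl)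
... | _ | s≤s (s≤s (s≤s z≤n))                                 = inj₂ (inj₂ (square-signedSum-by-weight v w≡))
... | _ | s≤s (s≤s (s≤s (s≤s z≤n)))                           = inj₂ (inj₂ (square-signedSum-by-weight v w≡))
... | _ | s≤s (s≤s (s≤s (s≤s (s≤s z≤n))))                     = inj₁ (inj₂ refl)
... | _ | s≤s (s≤s (s≤s (s≤s (s≤s (s≤s z≤n)))))               = inj₁ (inj₁ refl)
... | _ | s≤s (s≤s (s≤s (s≤s (s≤s (s≤s (s≤s z≤n))))))         = inj₂ (inj₁ (inj₂ (weight≡length⇒all-true v w≡)))

column : (Fin d → Vec Bool n) → Fin n → Vec Bool d
column b j = tabulate (λ k → lookup (b k) j)

lookup-lincomb : (c : Vec Bool d) (b : Fin d → F2^7) (j : Fin 7) →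
                 lookup (lincomb (lookup c) b) j ≡ c · column b j
lookup-lincomb []      b j = lookup-replicate j false
lookup-lincomb (x ∷ c) b j =
  trans (lookup-zipWith _xor_ j (if x then b zero else 𝟘) (lincomb (lookup c) (b ∘ suc)))
        (cong₂ _xor_ (lookup-select x) (lookup-lincomb c (b ∘ suc) j))
  where
  lookup-select : ∀ x → lookup (if x then b zero else 𝟘) j ≡ x ∧ lookup (b zero) j
  lookup-select false = lookup-replicate j false
  lookup-select true  = refl

signedSum-lincomb : (c : Vec Bool d) (b : Fin d → F2^7) →
                    signedSum (lincomb (lookup c) b) ≡ ∑[ j < 7 ] χ (c · column b j)
signedSum-lincomb c b = sum-cong-≗ (cong χ ∘ lookup-lincomb c b)

∃ᴮ⊎∀ᴮ : ∀ d {P Q : Vec Bool d → Set} → (∀ c → P c ⊎ Q c) → ∃ P ⊎ (∀ c → Q c)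
∃ᴮ⊎∀ᴮ ℕ.zero h with h []
... | inj₁ p = inj₁ ([] , p)
... | inj₂ q = inj₂ λ { [] → q }
∃ᴮ⊎∀ᴮ (suc d) h with ∃ᴮ⊎∀ᴮ d (h ∘ (false ∷_)) | ∃ᴮ⊎∀ᴮ d (h ∘ (true ∷_))
... | inj₁ (c , p) | _            = inj₁ (false ∷ c , p)
... | inj₂ _       | inj₁ (c , p) = inj₁ (true ∷ c , p)
... | inj₂ q₀      | inj₂ q₁      = inj₂ λ { (false ∷ c) → q₀ c ; (true ∷ c) → q₁ c }

span-not-balanced : (b : Fin 4 → F2^7) →
  (∀ c → lincomb c b ≈X 𝟘 → ∀ i → c i ≡ false) →
  ¬ (∀ (c : Vec Bool 4) → lincomb (lookup c) b ≈X 𝟘 ⊎ square (signedSum (lincomb (lookup c) b)) ≡ + 1)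
span-not-balanced b indep balanced = toWitnessFalse {a? = + 112 ≤? + 64} _ (begin
  + (7 ℕ.* 2 ^ 4)                                          ≤⟨ parseval-≥ (column b) ⟩
  ∑ᴮ 4 (λ c → square (∑[ j < 7 ] χ (c · column b j)))      ≡⟨ ∑ᴮ-cong 4 (λ c → cong square (signedSum-lincomb c b)) ⟨
  ∑ᴮ 4 (λ c → square (signedSum (lincomb (lookup c) b)))  ≤⟨ ∑ᴮ-≤ 4 48 ℤ.≤-refl nonzero-balanced ⟩
  + (2 ^ 4 ℕ.+ 48)                                         ∎)
  where
  open ℤ.≤-Reasoning
  nonzero-balanced : ∀ c → Nonzero c → square (signedSum (lincomb (lookup c) b)) ≤ + 1
  nonzero-balanced c (i , cᵢ≡1) with balanced c
  ... | inj₂ square≡1 = ℤ.≤-reflexive square≡1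
  ... | inj₁ c≈𝟘 with trans (sym cᵢ≡1) (indep (lookup c) c≈𝟘 i)
  ...   | ()

mainTheorem5 : (k : ℕ) → 1 ℕ.≤ k → k ℕ.≤ 3 →
    (U : F2^7 → Set) → IsSubspaceOfDim 4 U →
    (∀ u → U u → InV k u) →
    (∃ λ u → U u × InVν k 1 u) ⊎ (∃ λ u → U u × InVν k 2 u)
mainTheorem5 k _ _ U U-dim U⊆V = case ∃ᴮ⊎∀ᴮ 4 (classify-by-weight ∘ combination) of λ
  { (inj₁ (c , inj₁ S≡1)) → inj₁ (_ , combination∈U c , U⊆V _ (combination∈U c) , S≡1)
  ; (inj₁ (c , inj₂ S≡2)) → inj₂ (_ , combination∈U c , U⊆V _ (combination∈U c) , S≡2)
  ; (inj₂ balanced)       → ⊥-elim (span-not-balanced basis indep balanced)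
  }
  where
  open IsSubspaceOfDim U-dim
  combination : Vec Bool 4 → F2^7
  combination c = lincomb (lookup c) basis
  combination∈U : ∀ c → U (combination c)
  combination∈U c = Equivalence.from (spans _) (lookup c , inj₁ refl)
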